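{- Let $G=\langle\rho,\tau\rangle$ be a finite group with $\tau^2=1$, let $U$ be a core-free subgroup of $G$, and let $\Gamma=\mathrm{Mon}(G;U,\rho,\tau)$. Then for every $h\in G$, the valency of the vertex $Uh\langle\rho\rangle$ of $\Gamma$ is \[\frac{|\langle\rho\rangle|}{|\langle\rho\rangle\cap U^h|},\] where $U^h=h^{ -1}Uh$.
   Context: A subgroup $U\le G$ is core-free if $\bigcap_{g\in G}g^{ -1}Ug=1$. Monodromy graph: let $G=\langle\rho,\tau\rangle$ with $\tau^2=1$, $U$ core-free in $G$, $H=\langle\rho\rangle$, and $S$ a right transversal of $U$ in $G$. The graph $\mathrm{Mon}(G;U,\rho,\tau)$ has vertex set $\{UgH\mid g\in G\}$, edge set $\{\{UhH,Uh\tau H\}\mid h\in S\}$, and for $h\in S$ the multiplicity of the edge between $UhH$ and $Uh\tau H$ is $|D|$ where $D=\{g\in S\mid g\in UhH \text{ and } g\tau\in Uh\tau H\}$. The edge $\{UhH,Uh\tau H\}$ is a free edge if $h\tau\in Uh$, and a loop if $h\tau\notin Uh$ but $h\tau\in UhH$. The valency of a vertex is the number of edge-ends (darts) at it: the darts are the right cosets $Ug$ of $U$, the dart $Ug$ lies at the vertex $UgH$, and the darts $Ug$ and $Ug\tau$ form one edge (a free edge, contributing one dart, if they coincide; a loop contributes two darts at its vertex). -}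

module Defs where

open import Data.Nat using (ℕ; zero; suc)
open import Data.Integer using (ℤ; +_; -[1+_])
open import Data.Fin using (Fin)
open import Data.List using (List; []; _∷_)
open import Data.Product using (Σ; _×_; _,_; ∃)
open import Relation.Binary.PropositionalEquality using (_≡_)
open import Function.Definitions using (Injective)

record FinGroup (n : ℕ) : Set where
  field
    _∙_   : Fin n → Fin n → Fin n
    e     : Fin n
    inv   : Fin n → Fin n
    assoc : ∀ x y z → (x ∙ y) ∙ z ≡ x ∙ (y ∙ z)
    idˡ   : ∀ x → e ∙ x ≡ x
    idʳ   : ∀ x → x ∙ e ≡ x
    invˡ  : ∀ x → inv x ∙ x ≡ e
    invʳ  : ∀ x → x ∙ inv x ≡ e

module _ {n : ℕ} (G : FinGroup n) where
  open FinGroup G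

  pow : Fin n → ℕ → Fin n
  pow x zero    = e
  pow x (suc k) = x ∙ pow x k

  zpow : Fin n → ℤ → Fin n
  zpow x (+ k)      = pow x k
  zpow x -[1+ k ]   = inv (pow x (suc k))

  InCyclic : Fin n → Fin n → Set
  InCyclic ρ x = ∃ λ (k : ℤ) → x ≡ zpow ρ k

  data Letter : Set where
    ρL τL ρL⁻ τL⁻ : Letter

  evalWord : Fin n → Fin n → List Letter → Fin n
  evalWord ρ τ []          = e
  evalWord ρ τ (ρL  ∷ w)   = ρ ∙ evalWord ρ τ w
  evalWord ρ τ (τL  ∷ w)   = τ ∙ evalWord ρ τ w
  evalWord ρ τ (ρL⁻ ∷ w)   = inv ρ ∙ evalWord ρ τ w
  evalWord ρ τ (τL⁻ ∷ w)   = inv τ ∙ evalWord ρ τ w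

  Generates : Fin n → Fin n → Set
  Generates ρ τ = ∀ g → ∃ λ (w : List Letter) → evalWord ρ τ w ≡ g

  record IsSubgroup (U : Fin n → Set) : Set where
    field
      has-e   : U e
      closed∙ : ∀ {x y} → U x → U y → U (x ∙ y)
      closedi : ∀ {x} → U x → U (inv x)

  -- x ∈ g⁻¹ U g
  InConj : (Fin n → Set) → Fin n → Fin n → Set
  InConj U g x = U (g ∙ (x ∙ inv g))

  CoreFree : (Fin n → Set) → Set
  CoreFree U = ∀ x → (∀ g → InConj U g x) → x ≡ e

  InRightCoset : (Fin n → Set) → Fin n → Fin n → Set
  InRightCoset U g x = U (x ∙ inv g)

  IsRightTransversal : (Fin n → Set) → (Fin n → Set) → Set
  IsRightTransversal U S =
    ∀ g → Σ (Fin n) λ s → (S s × InRightCoset U g s)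
                         × (∀ s′ → S s′ → InRightCoset U g s′ → s′ ≡ s)

  InDoubleCoset : (Fin n → Set) → Fin n → Fin n → Fin n → Set
  InDoubleCoset U h ρ x = Σ (Fin n) λ u → U u × ∃ λ (k : ℤ) → x ≡ (u ∙ h) ∙ zpow ρ k

  -- Valency of the vertex U h ⟨ρ⟩ of Mon(G;U,ρ,τ), computed with transversal S:
  -- the darts are the right cosets U g (represented by g ∈ S), and the dart U g lies
  -- at the vertex U g ⟨ρ⟩ = U h ⟨ρ⟩ iff g ∈ U h ⟨ρ⟩.
  DartAt : (Fin n → Set) → (Fin n → Set) → Fin n → Fin n → Fin n → Set
  DartAt U S ρ h g = S g × InDoubleCoset U h ρ g

HasSize : {n : ℕ} → (Fin n → Set) → ℕ → Set
HasSize {n} P m =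
  Σ (Fin m → Fin n) λ f → Injective _≡_ _≡_ f × (∀ i → P (f i)) × (∀ x → P x → ∃ λ i → f i ≡ x)

-- Let H = ⟨ρ⟩. The darts at the vertex UhH are the right cosets of U contained in UhH, i.e. the
-- cosets Uhy with y ∈ H. Two of them agree, Uhy = Uhy′, exactly when y y′⁻¹ ∈ H ∩ U^h, so H is
-- partitioned into |H ∩ U^h| elements per dart. Concretely, choosing for each dart s some r_s ∈ H
-- with s ∈ U h r_s, the map (s , x) ↦ x r_s is a bijection from darts × (H ∩ U^h) onto H.
module Submission where

open import Defs
open import Level using (0ℓ)
open import Algebra.Bundles using (Group)
import Algebra.Properties.Group
open import Data.Nat using (ℕ; zero; suc; _*_)
open import Data.Integer as ℤ using (ℤ; +_; -[1+_])
import Data.Integer.Properties as ℤ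
open import Data.Fin using (Fin; combine; remQuot)
open import Data.Fin.Properties
  using (cantor-schröder-bernstein; combine-injective; combine-remQuot)
open import Data.Product using (_×_; ∃; _,_; proj₁; proj₂)
open import Function.Definitions using (Injective)
open import Relation.Binary.PropositionalEquality
  using (_≡_; refl; sym; trans; cong; cong₂; subst; isEquivalence; module ≡-Reasoning)

card-× : ∀ {a b c} (ψ : Fin a × Fin b → Fin c) →
         Injective _≡_ _≡_ ψ → (∀ t → ∃ λ p → ψ p ≡ t) → c ≡ a * b
card-× {a} {b} {c} ψ ψ-injective ψ-surjective =
  cantor-schröder-bernstein {f = section} {g = ψ∘remQuot} section-injective ψ∘remQuot-injective
  where
  section : Fin c → Fin (a * b)
  section t = let (i , j) = proj₁ (ψ-surjective t) in combine i j

  section-injective : Injective _≡_ _≡_ section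
  section-injective {t} {t′} eq =
    let (i , j) , ψij≡t = ψ-surjective t
        (i′ , j′) , ψi′j′≡t′ = ψ-surjective t′
        i≡i′ , j≡j′ = combine-injective i j i′ j′ eq
    in trans (sym ψij≡t) (trans (cong₂ (λ x y → ψ (x , y)) i≡i′ j≡j′) ψi′j′≡t′)

  ψ∘remQuot : Fin (a * b) → Fin c
  ψ∘remQuot x = ψ (remQuot b x)

  ψ∘remQuot-injective : Injective _≡_ _≡_ ψ∘remQuot
  ψ∘remQuot-injective {x} {y} eq =
    trans (sym (combine-remQuot {a} b x))
      (trans (cong (λ (i , j) → combine i j) (ψ-injective eq)) (combine-remQuot {a} b y))

+-suc : ∀ a b → a ℤ.+ ℤ.suc b ≡ ℤ.suc (a ℤ.+ b)
+-suc a b = trans (ℤ.+-comm a (ℤ.suc b)) (trans (ℤ.+-assoc (+ 1) b a) (cong ℤ.suc (ℤ.+-comm b a)))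

FinGroup→Group : ∀ {n} → FinGroup n → Group 0ℓ 0ℓ
FinGroup→Group {n} G = record
  { Carrier = Fin n
  ; _≈_ = _≡_
  ; _∙_ = _∙_
  ; ε = e
  ; _⁻¹ = inv
  ; isGroup = record
    { isMonoid = record
      { isSemigroup = record
        { isMagma = record { isEquivalence = isEquivalence ; ∙-cong = cong₂ _∙_ }
        ; assoc = assoc
        }
      ; identity = idˡ , idʳ
      }
    ; inverse = invˡ , invʳ
    ; ⁻¹-cong = cong inv
    }
  }
  where open FinGroup G

module FinGroupProperties {n : ℕ} (G : FinGroup n) where
  open FinGroup G
  open Algebra.Properties.Group (FinGroup→Group G) public
    using ( ε⁻¹≈ε; ⁻¹-involutive; ⁻¹-anti-homo-∙; ∙-cancelʳ
          ; //-rightDividesˡ; //-rightDividesʳ; \\-leftDividesʳ )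
  open ≡-Reasoning

  pow-sucʳ : ∀ x m → pow G x (suc m) ≡ pow G x m ∙ x
  pow-sucʳ x zero    = trans (idʳ x) (sym (idˡ x))
  pow-sucʳ x (suc m) = trans (cong (x ∙_) (pow-sucʳ x m)) (sym (assoc x (pow G x m) x))

  inv≡inv[x∙y]∙x : ∀ x y → inv y ≡ inv (x ∙ y) ∙ x
  inv≡inv[x∙y]∙x x y = begin
    inv y                  ≡⟨ //-rightDividesˡ x (inv y) ⟨
    (inv y ∙ inv x) ∙ x    ≡⟨ cong (_∙ x) (⁻¹-anti-homo-∙ x y) ⟨
    inv (x ∙ y) ∙ x        ∎

  zpow-suc : ∀ x k → zpow G x (ℤ.suc k) ≡ zpow G x k ∙ x
  zpow-suc x (+ m)            = pow-sucʳ x m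
  zpow-suc x -[1+ zero ]      = trans (sym ε⁻¹≈ε) (inv≡inv[x∙y]∙x x e)
  zpow-suc x -[1+ suc m ]     = inv≡inv[x∙y]∙x x (pow G x (suc m))

  zpow-pred : ∀ x k → zpow G x (ℤ.pred k) ≡ zpow G x k ∙ inv x
  zpow-pred x k = begin
    zpow G x (ℤ.pred k)                   ≡⟨ //-rightDividesʳ x _ ⟨
    (zpow G x (ℤ.pred k) ∙ x) ∙ inv x     ≡⟨ cong (_∙ inv x) (zpow-suc x (ℤ.pred k)) ⟨
    zpow G x (ℤ.suc (ℤ.pred k)) ∙ inv x   ≡⟨ cong (λ j → zpow G x j ∙ inv x) (ℤ.suc-pred k) ⟩
    zpow G x k ∙ inv x                    ∎

  module _ (x : Fin n) (a b : ℤ) (ih : zpow G x (a ℤ.+ b) ≡ zpow G x a ∙ zpow G x b) where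

    zpow-+-suc : zpow G x (a ℤ.+ ℤ.suc b) ≡ zpow G x a ∙ zpow G x (ℤ.suc b)
    zpow-+-suc = begin
      zpow G x (a ℤ.+ ℤ.suc b)            ≡⟨ cong (zpow G x) (+-suc a b) ⟩
      zpow G x (ℤ.suc (a ℤ.+ b))          ≡⟨ zpow-suc x (a ℤ.+ b) ⟩
      zpow G x (a ℤ.+ b) ∙ x              ≡⟨ cong (_∙ x) ih ⟩
      (zpow G x a ∙ zpow G x b) ∙ x       ≡⟨ assoc _ _ _ ⟩
      zpow G x a ∙ (zpow G x b ∙ x)       ≡⟨ cong (zpow G x a ∙_) (zpow-suc x b) ⟨
      zpow G x a ∙ zpow G x (ℤ.suc b)     ∎

    zpow-+-pred : zpow G x (a ℤ.+ ℤ.pred b) ≡ zpow G x a ∙ zpow G x (ℤ.pred b)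
    zpow-+-pred = begin
      zpow G x (a ℤ.+ ℤ.pred b)           ≡⟨ cong (zpow G x) (ℤ.+-pred a b) ⟩
      zpow G x (ℤ.pred (a ℤ.+ b))         ≡⟨ zpow-pred x (a ℤ.+ b) ⟩
      zpow G x (a ℤ.+ b) ∙ inv x          ≡⟨ cong (_∙ inv x) ih ⟩
      (zpow G x a ∙ zpow G x b) ∙ inv x   ≡⟨ assoc _ _ _ ⟩
      zpow G x a ∙ (zpow G x b ∙ inv x)   ≡⟨ cong (zpow G x a ∙_) (zpow-pred x b) ⟨
      zpow G x a ∙ zpow G x (ℤ.pred b)    ∎

  zpow-+ : ∀ x a b → zpow G x (a ℤ.+ b) ≡ zpow G x a ∙ zpow G x b
  zpow-+ x a (+ zero)      = trans (cong (zpow G x) (ℤ.+-identityʳ a)) (sym (idʳ _))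
  zpow-+ x a (+ suc m)     = zpow-+-suc x a (+ m) (zpow-+ x a (+ m))
  zpow-+ x a -[1+ zero ]   = zpow-+-pred x a (+ zero) (zpow-+ x a (+ zero))
  zpow-+ x a -[1+ suc m ]  = zpow-+-pred x a -[1+ m ] (zpow-+ x a -[1+ m ])

  zpow-neg : ∀ x k → inv (zpow G x k) ≡ zpow G x (ℤ.- k)
  zpow-neg x (+ zero)   = ε⁻¹≈ε
  zpow-neg x (+ suc m)  = refl
  zpow-neg x -[1+ m ]   = ⁻¹-involutive _

  InCyclic-∙ : ∀ {x y z} → InCyclic G x y → InCyclic G x z → InCyclic G x (y ∙ z)
  InCyclic-∙ {x} (a , refl) (b , refl) = a ℤ.+ b , sym (zpow-+ x a b)

  InCyclic-inv : ∀ {x y} → InCyclic G x y → InCyclic G x (inv y)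
  InCyclic-inv {x} (a , refl) = ℤ.- a , zpow-neg x a

module RightCosets {n : ℕ} (G : FinGroup n) (U : Fin n → Set) where
  open FinGroup G
  open FinGroupProperties G
  open ≡-Reasoning

  conj-quotient : ∀ h y r → (h ∙ y) ∙ inv (h ∙ r) ≡ h ∙ ((y ∙ inv r) ∙ inv h)
  conj-quotient h y r = begin
    (h ∙ y) ∙ inv (h ∙ r)         ≡⟨ cong ((h ∙ y) ∙_) (⁻¹-anti-homo-∙ h r) ⟩
    (h ∙ y) ∙ (inv r ∙ inv h)     ≡⟨ assoc h y _ ⟩
    h ∙ (y ∙ (inv r ∙ inv h))     ≡⟨ cong (h ∙_) (assoc y (inv r) (inv h)) ⟨
    h ∙ ((y ∙ inv r) ∙ inv h)     ∎

  InConj⇒InRightCoset : ∀ {h y r} → InConj G U h (y ∙ inv r) → InRightCoset G U (h ∙ r) (h ∙ y)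
  InConj⇒InRightCoset {h} {y} {r} = subst U (sym (conj-quotient h y r))

  InRightCoset⇒InConj : ∀ {h y r} → InRightCoset G U (h ∙ r) (h ∙ y) → InConj G U h (y ∙ inv r)
  InRightCoset⇒InConj {h} {y} {r} = subst U (conj-quotient h y r)

  InConj⇒InRightCoset-∙ : ∀ {h x y} → InConj G U h x → InRightCoset G U (h ∙ y) (h ∙ (x ∙ y))
  InConj⇒InRightCoset-∙ {h} {x} {y} x∈Uʰ =
    InConj⇒InRightCoset (subst (λ z → InConj G U h z) (sym (//-rightDividesʳ y x)) x∈Uʰ)

  InDoubleCoset⇒InRightCoset : ∀ {h ρ y} → InDoubleCoset G U h ρ y →
                               ∃ λ k → InRightCoset G U (h ∙ zpow G ρ k) y
  InDoubleCoset⇒InRightCoset {h} {ρ} (u , u∈U , k , refl) = k , subst U (sym quotient≡u) u∈U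
    where
    r = zpow G ρ k
    quotient≡u : ((u ∙ h) ∙ r) ∙ inv (h ∙ r) ≡ u
    quotient≡u = trans (cong (_∙ inv (h ∙ r)) (assoc u h r)) (//-rightDividesʳ (h ∙ r) u)

  InRightCoset⇒InDoubleCoset : ∀ {h ρ y} k → InRightCoset G U (h ∙ zpow G ρ k) y →
                               InDoubleCoset G U h ρ y
  InRightCoset⇒InDoubleCoset {h} {ρ} {y} k y∈Uhr =
    y ∙ inv (h ∙ r) , y∈Uhr , k , sym (trans (assoc _ h r) (//-rightDividesˡ (h ∙ r) y))
    where r = zpow G ρ k

  module _ (U-subgroup : IsSubgroup G U) where
    open IsSubgroup U-subgroup

    InRightCoset-sym : ∀ {g x} → InRightCoset G U g x → InRightCoset G U x g
    InRightCoset-sym {g} {x} x∈Ug = subst U inverse≡ (closedi x∈Ug)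
      where
      inverse≡ : inv (x ∙ inv g) ≡ g ∙ inv x
      inverse≡ = trans (⁻¹-anti-homo-∙ x (inv g)) (cong (_∙ inv x) (⁻¹-involutive g))

    InRightCoset-trans : ∀ {g y x} → InRightCoset G U g y → InRightCoset G U y x →
                         InRightCoset G U g x
    InRightCoset-trans {g} {y} {x} y∈Ug x∈Uy = subst U product≡ (closed∙ x∈Uy y∈Ug)
      where
      product≡ : (x ∙ inv y) ∙ (y ∙ inv g) ≡ x ∙ inv g
      product≡ = trans (assoc x (inv y) _) (cong (x ∙_) (\\-leftDividesʳ y (inv g)))

  transversal-unique : ∀ {S g s s′} → IsRightTransversal G U S → S s → S s′ →
                       InRightCoset G U g s → InRightCoset G U g s′ → s ≡ s′
  transversal-unique {g = g} S-transversal s∈S s′∈S s∈Ug s′∈Ug =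
    let (_ , _ , unique) = S-transversal g
    in trans (unique _ s∈S s∈Ug) (sym (unique _ s′∈S s′∈Ug))

module Enumeration {n m : ℕ} {P : Fin n → Set} (P-size : HasSize P m) where

  elem : Fin m → Fin n
  elem = proj₁ P-size

  elem-injective : Injective _≡_ _≡_ elem
  elem-injective = proj₁ (proj₂ P-size)

  elem-∈ : ∀ i → P (elem i)
  elem-∈ = proj₁ (proj₂ (proj₂ P-size))

  index : ∀ x → P x → Fin m
  index x x∈P = proj₁ (proj₂ (proj₂ (proj₂ P-size)) x x∈P)

  elem-index : ∀ x (x∈P : P x) → elem (index x x∈P) ≡ x
  elem-index x x∈P = proj₂ (proj₂ (proj₂ (proj₂ P-size)) x x∈P)

module Valency {n : ℕ} (G : FinGroup n) (ρ : Fin n) (U S : Fin n → Set)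
  (U-subgroup : IsSubgroup G U) (S-transversal : IsRightTransversal G U S) (h : Fin n)
  {val ordH ordHU : ℕ}
  (darts : HasSize (DartAt G U S ρ h) val)
  (cyclic : HasSize (InCyclic G ρ) ordH)
  (stabiliser : HasSize (λ x → InCyclic G ρ x × InConj G U h x) ordHU) where

  open FinGroup G
  open FinGroupProperties G
  open RightCosets G U
  module D = Enumeration darts
  module H = Enumeration cyclic
  module K = Enumeration stabiliser

  exponent : Fin val → ℤ
  exponent i = proj₁ (InDoubleCoset⇒InRightCoset (proj₂ (D.elem-∈ i)))

  r : Fin val → Fin n
  r i = zpow G ρ (exponent i)

  dart∈Uhr : ∀ i → InRightCoset G U (h ∙ r i) (D.elem i)
  dart∈Uhr i = proj₂ (InDoubleCoset⇒InRightCoset (proj₂ (D.elem-∈ i)))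

  product∈H : ∀ i j → InCyclic G ρ (K.elem j ∙ r i)
  product∈H i j = InCyclic-∙ (proj₁ (K.elem-∈ j)) (exponent i , refl)

  ψ : Fin val × Fin ordHU → Fin ordH
  ψ (i , j) = H.index _ (product∈H i j)

  ψ-elem : ∀ i j → H.elem (ψ (i , j)) ≡ K.elem j ∙ r i
  ψ-elem i j = H.elem-index _ (product∈H i j)

  dart∈Uh[xr] : ∀ i j → InRightCoset G U (h ∙ (K.elem j ∙ r i)) (D.elem i)
  dart∈Uh[xr] i j = InRightCoset-trans U-subgroup
    (InRightCoset-sym U-subgroup (InConj⇒InRightCoset-∙ (proj₂ (K.elem-∈ j))))
    (dart∈Uhr i)

  ψ-injective : Injective _≡_ _≡_ ψ
  ψ-injective {i , j} {i′ , j′} ψ≡ = pair-≡ i≡i′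
    where
    xr≡x′r′ : K.elem j ∙ r i ≡ K.elem j′ ∙ r i′
    xr≡x′r′ = trans (sym (ψ-elem i j)) (trans (cong H.elem ψ≡) (ψ-elem i′ j′))
    i≡i′ : i ≡ i′
    i≡i′ = D.elem-injective (transversal-unique S-transversal
      (proj₁ (D.elem-∈ i)) (proj₁ (D.elem-∈ i′))
      (dart∈Uh[xr] i j)
      (subst (λ y → InRightCoset G U (h ∙ y) (D.elem i′)) (sym xr≡x′r′) (dart∈Uh[xr] i′ j′)))
    pair-≡ : i ≡ i′ → (i , j) ≡ (i′ , j′)
    pair-≡ refl = cong (i ,_) (K.elem-injective (∙-cancelʳ (r i) _ _ xr≡x′r′))

  ψ-surjective : ∀ t → ∃ λ p → ψ p ≡ t
  ψ-surjective t = (i , j) , H.elem-injective (begin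
      H.elem (ψ (i , j))        ≡⟨ ψ-elem i j ⟩
      K.elem j ∙ r i            ≡⟨ cong (_∙ r i) (K.elem-index _ x∈K) ⟩
      (y ∙ inv (r i)) ∙ r i     ≡⟨ //-rightDividesˡ (r i) y ⟩
      y                         ∎)
    where
    open ≡-Reasoning
    y = H.elem t
    y∈H = H.elem-∈ t
    s = proj₁ (S-transversal (h ∙ y))
    s∈S = proj₁ (proj₁ (proj₂ (S-transversal (h ∙ y))))
    s∈Uhy = proj₂ (proj₁ (proj₂ (S-transversal (h ∙ y))))
    s-dart : DartAt G U S ρ h s
    s-dart = s∈S , InRightCoset⇒InDoubleCoset (proj₁ y∈H)
      (subst (λ z → InRightCoset G U (h ∙ z) s) (proj₂ y∈H) s∈Uhy)
    i = D.index s s-dart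
    hy∈Uhr : InRightCoset G U (h ∙ r i) (h ∙ y)
    hy∈Uhr = InRightCoset-trans U-subgroup
      (subst (InRightCoset G U (h ∙ r i)) (D.elem-index s s-dart) (dart∈Uhr i))
      (InRightCoset-sym U-subgroup s∈Uhy)
    x∈K : InCyclic G ρ (y ∙ inv (r i)) × InConj G U h (y ∙ inv (r i))
    x∈K = InCyclic-∙ y∈H (InCyclic-inv (exponent i , refl)) , InRightCoset⇒InConj hy∈Uhr
    j = K.index _ x∈K

  ordH≡val*ordHU : ordH ≡ val * ordHU
  ordH≡val*ordHU = card-× ψ ψ-injective ψ-surjective

lemma3p6 : {n : ℕ} (G : FinGroup n) (ρ τ : Fin n) (U S : Fin n → Set)
           → Generates G ρ τ
           → FinGroup._∙_ G τ τ ≡ FinGroup.e G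
           → IsSubgroup G U
           → CoreFree G U
           → IsRightTransversal G U S
           → (h : Fin n) (val ordH ordHU : ℕ)
           → HasSize (DartAt G U S ρ h) val
           → HasSize (InCyclic G ρ) ordH
           → HasSize (λ x → InCyclic G ρ x × InConj G U h x) ordHU
           → ordH ≡ val * ordHU
lemma3p6 G ρ _ U S _ _ U-subgroup _ S-transversal h _ _ _ darts cyclic stabiliser =
  Valency.ordH≡val*ordHU G ρ U S U-subgroup S-transversal h darts cyclic stabiliser
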